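{- Let $S[1..n]$ be a string over $\Sigma=[1..\sigma]$, $k\geq1$, and $S'=\#^{k-1}S\#^{k-1}$ with $\#\notin\Sigma$. Then $|[1..n]/\equiv_k|=|\mathcal L(ST^{2k-1}(S'))|\leq\min\{n,\sigma^{2k-1}+2k-2\}$.
   Context: Two positions $i,j\in[1..n]$ are $k$-equivalent, $i\equiv_k j$, iff $S''[i-k+1..i+k-1]=S''[j-k+1..j+k-1]$, where $S''[p]=\#$ if $p<1$ or $p>n$ and $S''[p]=S[p]$ otherwise; $[1..n]/\equiv_k$ denotes the set of equivalence classes. $ST^{m}(X)$ denotes the $m$-truncated suffix tree of $X$ (compact trie of all substrings of $X$ of length at most $m$), and for a compact trie $\mathcal T$, $\mathcal L(\mathcal T)$ is the set of leaves whose string depth equals the maximum string depth among all leaves. -}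

module Defs where

open import Data.Nat using (ℕ; zero; suc; _+_; _*_; _∸_; _≤_; _<?_)
open import Data.Integer as ℤ using (ℤ; +_; +[1+_]; -[1+_])
open import Data.Fin using (Fin; fromℕ<)
open import Data.Maybe using (Maybe; just; nothing)
open import Data.Vec using (Vec; lookup; toList)
open import Data.List using (List; []; _∷_; _++_; map; length; upTo; replicate; [_])
open import Data.List.Relation.Unary.All using (All)
open import Data.List.Relation.Unary.Any using (Any)
open import Data.List.Relation.Unary.AllPairs using (AllPairs)
open import Data.Product using (Σ; ∃; _×_)
open import Relation.Nullary using (¬_; yes; no)
open import Relation.Binary.PropositionalEquality using (_≡_)

-- Extended alphabet: `just a` is a letter a ∈ Σ (Σ ≅ Fin σ), `nothing` is the
-- fresh separator symbol #.
Char : ℕ → Set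
Char σ = Maybe (Fin σ)

S'' : ∀ {σ n} → Vec (Fin σ) n → ℤ → Char σ
S'' {n = n} S -[1+ _ ] = nothing
S'' {n = n} S (+ zero) = nothing
S'' {n = n} S +[1+ m ] with m <? n
... | yes m<n = just (lookup S (fromℕ< m<n))
... | no _    = nothing

window : ∀ {σ n} → Vec (Fin σ) n → ℕ → ℕ → List (Char σ)
window S k i =
  map (λ t → S'' S ((+ i ℤ.- + k) ℤ.+ + 1 ℤ.+ + t)) (upTo (2 * k ∸ 1))

_≡[_,_]_ : ∀ {σ n} → ℕ → Vec (Fin σ) n → ℕ → ℕ → Set
i ≡[ S , k ] j = window S k i ≡ window S k j

Pos : ℕ → ℕ → Set
Pos n i = (1 ≤ i) × (i ≤ n)

S' : ∀ {σ n} → Vec (Fin σ) n → ℕ → List (Char σ)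
S' S k = replicate (k ∸ 1) nothing ++ map just (toList S) ++ replicate (k ∸ 1) nothing

Substring : ∀ {A : Set} → List A → List A → Set
Substring {A} w X = Σ (List A) λ u → Σ (List A) λ v → X ≡ u ++ w ++ v

-- Nodes (string labels of loci) of the m-truncated suffix tree ST^m(X):
-- substrings of X of length at most m.
STNode : ∀ {A : Set} → ℕ → List A → List A → Set
STNode m X w = Substring w X × (length w ≤ m)

-- Leaves of ST^m(X): nodes without a child w·c.  (The leaves of the compact
-- trie are exactly these; their string depth is their length.)
STLeaf : ∀ {A : Set} → ℕ → List A → List A → Set
STLeaf {A} m X w = STNode m X w × (∀ (c : A) → ¬ STNode m X (w ++ [ c ]))

MaxLeaf : ∀ {A : Set} → ℕ → List A → List A → Set
MaxLeaf {A} m X w = STLeaf m X w × (∀ (w' : List A) → STLeaf m X w' → length w' ≤ length w)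

-- `NumClasses _~_ P c`: the set {x | P x}, taken modulo the equivalence _~_,
-- has exactly c classes: there is a list of c elements of P, pairwise
-- non-equivalent, such that every element of P is equivalent to one of them.
-- (With _~_ = _≡_ this is the cardinality of the set P.)
NumClasses : ∀ {A : Set} → (A → A → Set) → (A → Set) → ℕ → Set
NumClasses {A} _~_ P c =
  Σ (List A) λ l →
    All P l × AllPairs (λ x y → ¬ (x ~ y)) l ×
    (∀ x → P x → Any (x ~_) l) × (length l ≡ c)

module Submission where

-- Write k = 1 + k' and m = 2k - 1.  Reading the padded text
-- S' = #^{k'} S #^{k'} as a function  padded : ℕ → Char σ,  the window of a
-- position i ∈ [1..n] (the string S''[i-k+1..i+k-1]) is exactly the factor of
-- S' of length m starting at offset i - 1, and these n factors are all the
-- length-m factors of S' (|S'| = n - 1 + m).  In ST^m(S') every substring of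
-- length m is a leaf of maximal depth, and conversely, so the maximal leaves
-- are precisely the windows.  Hence ≡_k is the kernel of the map
-- i ↦ window i, whose image is the set of maximal leaves: both sets have the
-- same number c of classes.  The bounds follow by listing a superset of the
-- windows: the n windows themselves give c ≤ n; all words of length m over Σ
-- together with the windows of the first and last k' positions (the only
-- ones touching a #) give c ≤ σ^m + 2k'.

open import Defs
open import Data.Nat using (ℕ; zero; suc; _+_; _*_; _∸_; _^_; _≤_; _<_; _⊓_; z≤n; s≤s; _≤?_; _<?_)
open import Data.Nat.Properties
open import Data.Nat.Tactic.RingSolver using (solve-∀)
open import Data.Integer as ℤ using (ℤ; +[1+_]; _⊖_)
import Data.Integer.Properties as ℤP
open import Data.Integer.Solver using (module +-*-Solver)
open import Data.Fin using (Fin; fromℕ<)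
import Data.Fin.Properties as FinP
open import Data.Maybe using (just; nothing)
import Data.Maybe.Properties as MaybeP
open import Data.Vec using (Vec; lookup; toList)
import Data.Vec as Vec
open import Data.List using (List; []; _∷_; _++_; map; length; upTo; applyUpTo; replicate; [_]; deduplicate; allFin; cartesianProductWith)
open import Data.List.Properties using (length-map; length-++; length-upTo; length-applyUpTo; map-upTo; ∷-injective; length-tabulate; ≡-dec)
open import Data.List.Relation.Unary.All as All using (All; []; _∷_)
import Data.List.Relation.Unary.All.Properties as AllP
open import Data.List.Relation.Unary.Any as Any using (Any; here; there)
import Data.List.Relation.Unary.Any.Properties as AnyP
open import Data.List.Relation.Unary.AllPairs using (AllPairs; _∷_)
import Data.List.Relation.Unary.AllPairs.Properties as AllPairsP
open import Data.List.Relation.Unary.Unique.Propositional using (Unique)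
open import Data.List.Relation.Unary.Unique.DecSetoid.Properties using (deduplicate-!)
open import Data.List.Relation.Binary.Subset.Propositional using (_⊆_)
open import Data.List.Membership.Propositional using (_∈_)
open import Data.List.Membership.Propositional.Properties
  using (∈-map⁺; ∈-++⁺ˡ; ∈-++⁺ʳ; ∈-allFin; ∈-applyUpTo⁺; ∈-cartesianProductWith⁺)
open import Data.Product using (Σ; ∃; _×_; _,_; proj₁; proj₂)
open import Data.Empty using (⊥-elim)
open import Function using (_∘_)
open import Relation.Nullary using (¬_; Dec; yes; no)
open import Relation.Binary.Definitions using (DecidableEquality)
import Relation.Binary.Construct.On as On
open import Relation.Binary.PropositionalEquality hiding ([_])

private variable A B C : Set

remove : ∀ {x : A} (ys : List A) → x ∈ ys → List A
remove (_ ∷ ys) (here _)  = ys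
remove (y ∷ ys) (there p) = y ∷ remove ys p

length-remove : ∀ {x : A} (ys : List A) (p : x ∈ ys) → length ys ≡ suc (length (remove ys p))
length-remove (_ ∷ ys) (here _)  = refl
length-remove (y ∷ ys) (there p) = cong suc (length-remove ys p)

∈-remove : ∀ {x y : A} (ys : List A) (p : x ∈ ys) → y ∈ ys → ¬ y ≡ x → y ∈ remove ys p
∈-remove (_ ∷ ys) (here refl) (here refl) y≢x = ⊥-elim (y≢x refl)
∈-remove (_ ∷ ys) (here _)    (there q)   _   = q
∈-remove (_ ∷ ys) (there p)   (here e)    _   = here e
∈-remove (_ ∷ ys) (there p)   (there q)   y≢x = there (∈-remove ys p q y≢x)

unique-⊆⇒length-≤ : ∀ {xs ys : List A} → Unique xs → xs ⊆ ys → length xs ≤ length ys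
unique-⊆⇒length-≤ {xs = []}     _              _   = z≤n
unique-⊆⇒length-≤ {xs = x ∷ xs} {ys} (x∉xs ∷ u) sub =
  subst (suc (length xs) ≤_) (sym (length-remove ys x∈ys))
    (s≤s (unique-⊆⇒length-≤ u (λ y∈xs → ∈-remove ys x∈ys (sub (there y∈xs)) (differs y∈xs))))
  where
  x∈ys : x ∈ ys
  x∈ys = sub (here refl)
  differs : ∀ {y} → y ∈ xs → ¬ y ≡ x
  differs y∈xs y≡x = All.lookup x∉xs y∈xs (sym y≡x)

classes-bound : ∀ {Q : A → Set} {c} (ys : List A) →
  NumClasses _≡_ Q c → (∀ w → Q w → w ∈ ys) → c ≤ length ys
classes-bound ys (l , Ql , distinct , _ , refl) covered =
  unique-⊆⇒length-≤ distinct (λ w∈l → covered _ (All.lookup Ql w∈l))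

kernel-classes : ∀ {P : A → Set} (W : A → B) → DecidableEquality B → (xs : List A) →
  (∀ x → P x → x ∈ xs) → All P xs → ∃ λ c → NumClasses (λ i j → W i ≡ W j) P c
kernel-classes {P = P} W _≟_ xs complete sound =
  length reps , reps , AllP.deduplicate⁺ sameImage? sound , distinct , covered , refl
  where
  sameImage? : ∀ x y → Dec (W x ≡ W y)
  sameImage? x y = W x ≟ W y
  reps : List _
  reps = deduplicate sameImage? xs
  distinct : AllPairs (λ i j → ¬ W i ≡ W j) reps
  distinct = deduplicate-! (On.decSetoid (decSetoid _≟_) W) xs
  covered : ∀ x → P x → Any (λ j → W x ≡ W j) reps
  covered x px = AnyP.deduplicate⁺ sameImage? (λ e q → trans q (sym e)) (Any.map (cong W) (complete x px))

image-classes : ∀ {P : A → Set} {Q : B → Set} {c} (W : A → B) →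
  (∀ x → P x → Q (W x)) → (∀ w → Q w → ∃ λ x → P x × w ≡ W x) →
  NumClasses (λ i j → W i ≡ W j) P c → NumClasses _≡_ Q c
image-classes {Q = Q} W into onto (l , Pl , distinct , covered , len) =
  map W l , AllP.map⁺ (All.map (into _) Pl) , AllPairsP.map⁺ distinct ,
  cover , trans (length-map W l) len
  where
  cover : ∀ w → Q w → Any (w ≡_) (map W l)
  cover w qw with onto w qw
  ... | x , px , refl = AnyP.map⁺ (covered x px)

length-cartesianProductWith : ∀ (f : A → B → C) xs ys →
  length (cartesianProductWith f xs ys) ≡ length xs * length ys
length-cartesianProductWith f []       ys = refl
length-cartesianProductWith f (x ∷ xs) ys =
  trans (length-++ (map (f x) ys))
        (cong₂ _+_ (length-map (f x) ys) (length-cartesianProductWith f xs ys))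

words : List A → ℕ → List (List A)
words as zero    = [ [] ]
words as (suc m) = cartesianProductWith _∷_ as (words as m)

length-words : ∀ (as : List A) m → length (words as m) ≡ length as ^ m
length-words as zero    = refl
length-words as (suc m) =
  trans (length-cartesianProductWith _∷_ as (words as m)) (cong (length as *_) (length-words as m))

∈-words : ∀ {as : List A} {w} → All (_∈ as) w → w ∈ words as (length w)
∈-words []             = here refl
∈-words (a∈as ∷ w⊆as) = ∈-cartesianProductWith⁺ _∷_ a∈as (∈-words w⊆as)

applyUpTo-cong : ∀ {f g : ℕ → A} L → (∀ t → t < L → f t ≡ g t) → applyUpTo f L ≡ applyUpTo g L
applyUpTo-cong zero    _  = refl
applyUpTo-cong (suc L) eq = cong₂ _∷_ (eq 0 (s≤s z≤n)) (applyUpTo-cong L (λ t t<L → eq (suc t) (s≤s t<L)))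

applyUpTo-const : ∀ (c : A) L → applyUpTo (λ _ → c) L ≡ replicate L c
applyUpTo-const c zero    = refl
applyUpTo-const c (suc L) = cong (c ∷_) (applyUpTo-const c L)

applyUpTo-++ : ∀ (f : ℕ → A) a b → applyUpTo f (a + b) ≡ applyUpTo f a ++ applyUpTo (f ∘ (a +_)) b
applyUpTo-++ f zero    b = refl
applyUpTo-++ f (suc a) b = cong (f 0 ∷_) (applyUpTo-++ (f ∘ suc) a b)

applyUpTo-toList : ∀ {n} (g : A → B) (S : Vec A n) (h : ℕ → B) →
  (∀ q (q<n : q < n) → h q ≡ g (lookup S (fromℕ< q<n))) → applyUpTo h n ≡ map g (toList S)
applyUpTo-toList g Vec.[]       h eq = refl
applyUpTo-toList g (x Vec.∷ S) h eq =
  cong₂ _∷_ (eq 0 (s≤s z≤n)) (applyUpTo-toList g S (h ∘ suc) (λ q q<n → eq (suc q) (s≤s q<n)))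

applyUpTo-split⁻ : ∀ (f : ℕ → A) L u r → applyUpTo f L ≡ u ++ r →
  u ≡ applyUpTo f (length u) × Σ ℕ λ L' → L ≡ length u + L' × r ≡ applyUpTo (f ∘ (length u +_)) L'
applyUpTo-split⁻ f L       []      r eq = refl , L , refl , sym eq
applyUpTo-split⁻ f zero    (x ∷ u) r ()
applyUpTo-split⁻ f (suc L) (x ∷ u) r eq with ∷-injective eq
... | fx≡x , rest with applyUpTo-split⁻ (f ∘ suc) L u r rest
... | u≡ , L' , L≡ , r≡ = cong₂ _∷_ (sym fx≡x) u≡ , L' , cong suc L≡ , r≡

factor⁺ : ∀ (f : ℕ → A) i m r → Substring (applyUpTo (f ∘ (i +_)) m) (applyUpTo f (i + (m + r)))
factor⁺ f i m r =
  applyUpTo f i , applyUpTo (f ∘ (i +_) ∘ (m +_)) r ,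
  trans (applyUpTo-++ f i (m + r)) (cong (applyUpTo f i ++_) (applyUpTo-++ (f ∘ (i +_)) m r))

factor⁻ : ∀ (f : ℕ → A) L u w v → applyUpTo f L ≡ u ++ w ++ v →
  w ≡ applyUpTo (f ∘ (length u +_)) (length w) × Σ ℕ λ L₂ → L ≡ length u + (length w + L₂)
factor⁻ f L u w v eq with applyUpTo-split⁻ f L u (w ++ v) eq
... | _ , L₁ , L≡ , wv≡ with applyUpTo-split⁻ (f ∘ (length u +_)) L₁ w v (sym wv≡)
... | w≡ , L₂ , L₁≡ , _ = w≡ , L₂ , trans L≡ (cong (length u +_) L₁≡)

maxLeaf⁺ : ∀ {m} {X w : List A} → Substring w X → length w ≡ m → MaxLeaf m X w
maxLeaf⁺ {m = m} {X} {w} sub len = ((sub , ≤-reflexive len) , noChild) , depth≤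
  where
  noChild : ∀ c → ¬ STNode m X (w ++ [ c ])
  noChild c (_ , len≤) = <-irrefl refl (begin-strict
    m                    <⟨ n<1+n m ⟩
    suc m                ≡⟨ +-comm 1 m ⟩
    m + 1                ≡⟨ cong (_+ 1) (sym len) ⟩
    length w + 1         ≡⟨ sym (length-++ w) ⟩
    length (w ++ [ c ])  ≤⟨ len≤ ⟩
    m                    ∎)
    where open ≤-Reasoning
  depth≤ : ∀ w' → STLeaf m X w' → length w' ≤ length w
  depth≤ w' ((_ , len'≤) , _) = subst (length w' ≤_) (sym len) len'≤

maxLeaf-length : ∀ {m} {X w w' : List A} → MaxLeaf m X w → Substring w' X → length w' ≡ m →
  length w ≡ m
maxLeaf-length (((_ , len≤) , _) , deepest) sub' len' =
  ≤-antisym len≤ (subst (_≤ _) len' (deepest _ (proj₁ (maxLeaf⁺ sub' len'))))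

S''-left : ∀ {σ n} (S : Vec (Fin σ) n) a b → a ≤ b → S'' S (a ⊖ b) ≡ nothing
S''-left S a b a≤b rewrite ℤP.⊖-≤ a≤b with b ∸ a
... | zero  = refl
... | suc _ = refl

S''-right : ∀ {σ n} (S : Vec (Fin σ) n) q → n ≤ q → S'' S +[1+ q ] ≡ nothing
S''-right {n = n} S q n≤q with q <? n
... | yes q<n = ⊥-elim (<⇒≱ q<n n≤q)
... | no _    = refl

S''-inside : ∀ {σ n} (S : Vec (Fin σ) n) q (q<n : q < n) → S'' S +[1+ q ] ≡ just (lookup S (fromℕ< q<n))
S''-inside {n = n} S q q<n with q <? n
... | yes q<n' = cong (just ∘ lookup S) (FinP.fromℕ<-cong q q refl q<n' q<n)
... | no q≮n   = ⊥-elim (q≮n q<n)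

-- The index (+ i - + k) + 1 + t of the t-th letter of the window of
-- position i, in the form used by 'padded' below.
module _ where
  open import Data.Integer using (+_)

  window-index : ∀ i' k' t → (+ suc i' ℤ.- + suc k') ℤ.+ + 1 ℤ.+ + t ≡ suc (i' + t) ⊖ k'
  window-index i' k' t = begin
    (+ suc i' ℤ.- + suc k') ℤ.+ + 1 ℤ.+ + t
      ≡⟨ cong (λ z → (+ suc i' ℤ.- z) ℤ.+ + 1 ℤ.+ + t) (ℤP.pos-+ 1 k') ⟩
    (+ suc i' ℤ.- (+ 1 ℤ.+ + k')) ℤ.+ + 1 ℤ.+ + t ≡⟨ regroup (+ suc i') (+ k') (+ t) ⟩
    (+ suc i' ℤ.+ + t) ℤ.- + k'                    ≡⟨ cong (ℤ._- + k') (sym (ℤP.pos-+ (suc i') t)) ⟩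
    + (suc i' + t) ℤ.- + k'                        ≡⟨ ℤP.m-n≡m⊖n (suc i' + t) k' ⟩
    suc (i' + t) ⊖ k' ∎
    where
    open ≡-Reasoning
    open +-*-Solver using (solve; _:+_; _:-_; _:=_; con)
    regroup : ∀ (a b t : ℤ) → ((a ℤ.- (ℤ.+ 1 ℤ.+ b)) ℤ.+ ℤ.+ 1) ℤ.+ t ≡ (a ℤ.+ t) ℤ.- b
    regroup = solve 3 (λ a b t → ((a :- (con (ℤ.+ 1) :+ b)) :+ con (ℤ.+ 1)) :+ t := (a :+ t) :- b) refl

-- Arithmetic facts about the window length m = 2k - 1 = k' + (1 + k').
window-length≡ : ∀ k' → k' + suc (k' + 0) ≡ suc (k' + k')
window-length≡ = solve-∀

padded-length-split : ∀ k' i r → k' + ((suc i + r) + k') ≡ i + ((k' + suc (k' + 0)) + r)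
padded-length-split = solve-∀

window-start<n : ∀ k' n u L₂ → k' + (n + k') ≡ u + ((k' + suc (k' + 0)) + L₂) → u < n
window-start<n k' n u L₂ eq = +-cancelʳ-≤ (k' + k') (suc u) n (begin
  suc u + (k' + k')                ≡⟨ shift k' u ⟩
  u + (k' + suc (k' + 0))          ≤⟨ +-monoʳ-≤ u (m≤m+n (k' + suc (k' + 0)) L₂) ⟩
  u + ((k' + suc (k' + 0)) + L₂)   ≡⟨ sym eq ⟩
  k' + (n + k')                    ≡⟨ swap k' n ⟩
  n + (k' + k')                    ∎)
  where
  open ≤-Reasoning
  shift : ∀ k' u → suc u + (k' + k') ≡ u + (k' + suc (k' + 0))
  shift = solve-∀
  swap : ∀ k' n → k' + (n + k') ≡ n + (k' + k')
  swap = solve-∀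

interior-offset : ∀ {k' i' t n} → k' ≤ i' → k' + suc i' ≤ n → t ≤ k' + k' → i' + t ∸ k' < n
interior-offset {k'} {i'} {t} {n} k'≤i' k'+i<n t≤2k' = +-cancelʳ-≤ k' _ _ (begin
  suc (i' + t ∸ k') + k'  ≡⟨ cong suc (m∸n+n≡m (≤-trans k'≤i' (m≤m+n i' t))) ⟩
  suc (i' + t)            ≤⟨ s≤s (+-monoʳ-≤ i' t≤2k') ⟩
  suc (i' + (k' + k'))    ≡⟨ cong suc (sym (+-assoc i' k' k')) ⟩
  suc (i' + k') + k'      ≤⟨ +-monoˡ-≤ k' (subst (_≤ n) (+-comm k' (suc i')) k'+i<n) ⟩
  n + k'                  ∎)
  where open ≤-Reasoning

module Padded {σ n : ℕ} (S : Vec (Fin σ) n) (k' : ℕ) where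

  k m : ℕ
  k = suc k'
  m = 2 * k ∸ 1

  -- The p-th letter (from 0) of S'.
  padded : ℕ → Char σ
  padded p = S'' S (suc p ⊖ k')

  padded-shift : ∀ q → padded (k' + q) ≡ S'' S +[1+ q ]
  padded-shift q = cong (S'' S) (begin
    suc (k' + q) ⊖ k'       ≡⟨ ℤP.⊖-≥ (≤-trans (m≤m+n k' q) (n≤1+n _)) ⟩
    ℤ.+ (suc (k' + q) ∸ k') ≡⟨ cong (λ z → ℤ.+ (z ∸ k')) (sym (+-suc k' q)) ⟩
    ℤ.+ (k' + suc q ∸ k')   ≡⟨ cong ℤ.+_ (m+n∸m≡n k' (suc q)) ⟩
    ℤ.+ suc q               ∎)
    where open ≡-Reasoning

  S'≡padded : S' S k ≡ applyUpTo padded (k' + (n + k'))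
  S'≡padded = sym (begin
    applyUpTo padded (k' + (n + k'))
      ≡⟨ applyUpTo-++ padded k' (n + k') ⟩
    applyUpTo padded k' ++ applyUpTo (padded ∘ (k' +_)) (n + k')
      ≡⟨ cong (applyUpTo padded k' ++_) (applyUpTo-++ (padded ∘ (k' +_)) n k') ⟩
    applyUpTo padded k' ++ applyUpTo (padded ∘ (k' +_)) n ++ applyUpTo (padded ∘ (k' +_) ∘ (n +_)) k'
      ≡⟨ cong₂ (λ a b → a ++ applyUpTo (padded ∘ (k' +_)) n ++ b) leftPad rightPad ⟩
    replicate k' nothing ++ applyUpTo (padded ∘ (k' +_)) n ++ replicate k' nothing
      ≡⟨ cong (λ a → replicate k' nothing ++ a ++ replicate k' nothing) text ⟩
    S' S k ∎)
    where
    open ≡-Reasoning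
    leftPad : applyUpTo padded k' ≡ replicate k' nothing
    leftPad = trans (applyUpTo-cong k' (λ t t<k' → S''-left S (suc t) k' t<k')) (applyUpTo-const nothing k')
    rightPad : applyUpTo (padded ∘ (k' +_) ∘ (n +_)) k' ≡ replicate k' nothing
    rightPad = trans (applyUpTo-cong k' (λ t _ → trans (padded-shift (n + t)) (S''-right S (n + t) (m≤m+n n t))))
                     (applyUpTo-const nothing k')
    text : applyUpTo (padded ∘ (k' +_)) n ≡ map just (toList S)
    text = applyUpTo-toList just S (padded ∘ (k' +_)) (λ q q<n → trans (padded-shift q) (S''-inside S q q<n))

  W : ℕ → List (Char σ)
  W = window S k

  window≡factor : ∀ i' → W (suc i') ≡ applyUpTo (padded ∘ (i' +_)) m
  window≡factor i' = trans (map-upTo _ m) (applyUpTo-cong m (λ t _ → cong (S'' S) (window-index i' k' t)))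

  length-window : ∀ i → length (W i) ≡ m
  length-window i = trans (length-map _ (upTo m)) (length-upTo m)

  window-maxLeaf : ∀ j → Pos n j → MaxLeaf m (S' S k) (W j)
  window-maxLeaf (suc i') (_ , i'<n) = maxLeaf⁺ substring (length-window (suc i'))
    where
    r : ℕ
    r = n ∸ suc i'
    length≡ : k' + (n + k') ≡ i' + (m + r)
    length≡ = trans (cong (λ z → k' + (z + k')) (sym (m+[n∸m]≡n i'<n))) (padded-length-split k' i' r)
    substring : Substring (W (suc i')) (S' S k)
    substring = subst₂ Substring (sym (window≡factor i'))
      (sym (trans S'≡padded (cong (applyUpTo padded) length≡))) (factor⁺ padded i' m r)

  maxLeaf-window : 1 ≤ n → ∀ w → MaxLeaf m (S' S k) w → ∃ λ j → Pos n j × w ≡ W j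
  maxLeaf-window 1≤n w leaf@((((u , v , S'≡uwv) , _) , _) , _)
    with factor⁻ padded (k' + (n + k')) u w v (trans (sym S'≡padded) S'≡uwv)
  ... | w≡ , L₂ , length≡ =
    suc (length u) ,
    (s≤s z≤n , window-start<n k' n (length u) L₂ (trans length≡ (cong (λ z → length u + (z + L₂)) |w|≡m))) ,
    trans w≡ (trans (cong (applyUpTo _) |w|≡m) (sym (window≡factor (length u))))
    where
    |w|≡m : length w ≡ m
    |w|≡m = maxLeaf-length leaf (proj₁ (proj₁ (proj₁ (window-maxLeaf 1 (≤-refl , 1≤n))))) (length-window 1)

  positions : List ℕ
  positions = applyUpTo suc n

  positions-complete : ∀ j → Pos n j → j ∈ positions
  positions-complete (suc i') (_ , i'<n) = ∈-applyUpTo⁺ suc i'<n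

  positions-sound : All (Pos n) positions
  positions-sound = AllP.applyUpTo⁺₁ suc n (λ i'<n → s≤s z≤n , i'<n)

  maxLeaf-covered : 1 ≤ n → ∀ {ys} → (∀ j → Pos n j → W j ∈ ys) → ∀ w → MaxLeaf m (S' S k) w → w ∈ ys
  maxLeaf-covered 1≤n windows∈ w leaf with maxLeaf-window 1≤n w leaf
  ... | j , pos , refl = windows∈ j pos

  letters : List (Char σ)
  letters = map just (allFin σ)

  -- Only the first and last k' positions have a window touching a #.
  boundary : List ℕ
  boundary = applyUpTo suc k' ++ applyUpTo (n ∸_) k'

  -- Every window is a word over Σ or the window of a boundary position.
  candidates : List (List (Char σ))
  candidates = words letters m ++ map W boundary

  length-candidates : length candidates ≡ σ ^ m + (k' + k')
  length-candidates = begin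
    length (words letters m ++ map W boundary)          ≡⟨ length-++ (words letters m) ⟩
    length (words letters m) + length (map W boundary)  ≡⟨ cong₂ _+_ (length-words letters m) (length-map W boundary) ⟩
    length letters ^ m + length boundary                ≡⟨ cong₂ (λ a b → a ^ m + b) |letters| (length-++ (applyUpTo suc k')) ⟩
    σ ^ m + (length (applyUpTo suc k') + length (applyUpTo (n ∸_) k'))
      ≡⟨ cong (σ ^ m +_) (cong₂ _+_ (length-applyUpTo suc k') (length-applyUpTo (n ∸_) k')) ⟩
    σ ^ m + (k' + k') ∎
    where
    open ≡-Reasoning
    |letters| : length letters ≡ σ
    |letters| = trans (length-map just (allFin σ)) (length-tabulate (λ a → a))

  interior-window : ∀ i' → k' ≤ i' → k' + suc i' ≤ n → All (_∈ letters) (W (suc i'))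
  interior-window i' k'≤i' inside = subst (All (_∈ letters)) (sym (window≡factor i'))
    (AllP.applyUpTo⁺₁ (padded ∘ (i' +_)) m letter)
    where
    letter : ∀ {t} → t < m → padded (i' + t) ∈ letters
    letter {t} t<m = subst (_∈ letters) (sym (trans (cong padded (sym i'+t≡)) (padded-shift q)))
      (subst (_∈ letters) (sym (S''-inside S q q<n)) (∈-map⁺ just (∈-allFin _)))
      where
      q : ℕ
      q = i' + t ∸ k'
      i'+t≡ : k' + q ≡ i' + t
      i'+t≡ = m+[n∸m]≡n (≤-trans k'≤i' (m≤m+n i' t))
      q<n : q < n
      q<n = interior-offset k'≤i' inside (≤-pred (subst (t <_) (window-length≡ k') t<m))

  window-candidate : ∀ j → Pos n j → W j ∈ candidates
  window-candidate (suc i') (_ , i'<n) with suc i' ≤? k'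
  ... | yes j≤k' = ∈-++⁺ʳ (words letters m) (∈-map⁺ W (∈-++⁺ˡ (∈-applyUpTo⁺ suc j≤k')))
  ... | no j≰k' with n ∸ suc i' <? k'
  ...   | yes near-end = ∈-++⁺ʳ (words letters m) (∈-map⁺ W (∈-++⁺ʳ (applyUpTo suc k')
            (subst (_∈ applyUpTo (n ∸_) k') (m∸[m∸n]≡n i'<n) (∈-applyUpTo⁺ (n ∸_) near-end))))
  ...   | no far-from-end = ∈-++⁺ˡ (subst (λ z → W (suc i') ∈ words letters z) (length-window (suc i'))
            (∈-words (interior-window i' (≤-pred (≰⇒> j≰k')) (m≤o∸n⇒m+n≤o k' i'<n (≮⇒≥ far-from-end)))))

  window-dec : DecidableEquality (List (Char σ))
  window-dec = ≡-dec (MaybeP.≡-dec FinP._≟_)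

lemma13 : (σ n k : ℕ) → (S : Vec (Fin σ) n) → 1 ≤ n → 1 ≤ k →
    ∃ λ c →
      NumClasses (λ i j → i ≡[ S , k ] j) (Pos n) c
      × NumClasses _≡_ (MaxLeaf (2 * k ∸ 1) (S' S k)) c
      × c ≤ n ⊓ (σ ^ (2 * k ∸ 1) + (2 * k ∸ 2))
lemma13 σ n (suc k') S 1≤n _ =
  c , proj₂ classes , leafClasses , ⊓-glb at-most-n at-most-words
  where
  open Padded S k'
  classes : ∃ λ c → NumClasses (λ i j → W i ≡ W j) (Pos n) c
  classes = kernel-classes W window-dec positions positions-complete positions-sound
  c : ℕ
  c = proj₁ classes
  leafClasses : NumClasses _≡_ (MaxLeaf m (S' S k)) c
  leafClasses = image-classes W window-maxLeaf (maxLeaf-window 1≤n) (proj₂ classes)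
  at-most-n : c ≤ n
  at-most-n = subst (c ≤_) (trans (length-map W positions) (length-applyUpTo suc n))
    (classes-bound (map W positions) leafClasses
      (maxLeaf-covered 1≤n (λ j pos → ∈-map⁺ W (positions-complete j pos))))
  at-most-words : c ≤ σ ^ m + (2 * k ∸ 2)
  at-most-words = subst (λ z → c ≤ σ ^ m + z) (sym (cong (_∸ 1) (window-length≡ k')))
    (subst (c ≤_) length-candidates
      (classes-bound candidates leafClasses (maxLeaf-covered 1≤n window-candidate)))
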